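{- Let $N$ be a net, $P$ a GR-process of $N$, $\sigma\in\mathrm{Lin}(P)$ and $\sigma''\in\mathrm{FS}(N)$ with $\sigma''\le\sigma$. Then there is a finite GR-process $P''$ of $N$ with $\sigma''\in\mathrm{Lin}(P'')$ and $P''\le P$.
   Context: A net is $N=(S,T,F,M_0)$ with $S,T$ disjoint, $F:(S\times T)\cup(T\times S)\to\mathbb{N}$, $M_0:S\to\mathbb{N}$, each transition having finitely many and at least one preplace and finitely many postplaces. ${}^\bullet x(y)=F(y,x)$, $x^\bullet(y)=F(x,y)$ (multisets), extended additively to finite multisets. For markings $M,M'$ and finite non-empty multiset $G$ of transitions, $M\xrightarrow{G}M'$ iff ${}^\bullet G\le M$ and $M'=(M-{}^\bullet G)+G^\bullet$. For a finite or infinite word $\sigma=t_1t_2\cdots$, $M\xrightarrow{\sigma}$ means $M\xrightarrow{\{t_1\}}M_1\xrightarrow{\{t_2\}}\cdots$. $\mathrm{FS}^\infty(N)$: words with $M_0\xrightarrow{\sigma}$; $\mathrm{FS}(N)$: finite ones. $\le$ on words is the prefix order. A GR-process of $N$ is $P=(\mathcal N,\pi)$ where $\mathcal N=(\mathcal S,\mathcal T,\mathcal F,\mathcal M_0)$ is a net such that each place $s$ has $|{}^\bullet s|\le1\ge|s^\bullet|$ and $\mathcal M_0(s)=1$ if ${}^\bullet s=\emptyset$, else $0$; $\mathcal F^+$ (transitive closure of $\{(x,y)\mid\mathcal F(x,y)>0\}$) is irreflexive; each $u\in\mathcal T$ has finitely many $t$ with $(t,u)\in\mathcal F^+$; and $\pi$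 maps places to places, transitions to transitions, with $M_0(s)=|\pi^{ -1}(s)\cap\mathcal M_0|$ and $F(s,\pi(t))=|\pi^{ -1}(s)\cap{}^\bullet t|$, $F(\pi(t),s)=|\pi^{ -1}(s)\cap t^\bullet|$ for all $t\in\mathcal T,s\in S$. Finite means $\mathcal T$ finite. $P'\le P$ (prefix) iff places and transitions of $P'$ are subsets of those of $P$, initial markings coincide, and flow and $\pi$ of $P'$ are the restrictions of those of $P$. $P$ with transitions $\mathcal T$ and $\sigma=t_0t_1\cdots\in\mathrm{FS}^\infty(N)$ are compatible iff there is a bijection $\mathrm{pos}:\mathcal T\to I$ ($I=\{0,\dots,|\sigma|-1\}$ if $\sigma$ finite, $I=\mathbb N$ otherwise) with $\pi(t)=t_{\mathrm{pos}(t)}$ and $(t,t')\in\mathcal F^+\Rightarrow\mathrm{pos}(t)<\mathrm{pos}(t')$. $\mathrm{Lin}(P)$ is the set of firing sequences compatible with $P$. -}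

module Defs where

open import Data.Nat using (ℕ; zero; suc; _+_; _∸_; _≤_; _<_)
open import Data.List using (List; []; _∷_; length; lookup; map)
open import Data.Nat.ListAction using (sum)
open import Data.List.Membership.Propositional using (_∈_)
open import Data.List.Relation.Unary.All using (All)
open import Data.List.Relation.Unary.Unique.Propositional using (Unique)
open import Data.Fin using (Fin; toℕ)
open import Data.Sum using (_⊎_; inj₁; inj₂)
open import Data.Product using (Σ; ∃; _×_; _,_)
open import Data.Empty using (⊥)
open import Data.Unit using (⊤)
open import Relation.Nullary using (¬_)
open import Relation.Binary.PropositionalEquality using (_≡_)
open import Relation.Binary.Construct.Closure.Transitive using (TransClosure)
open import Function.Definitions using (Injective; Bijective)

Finite : Set → Set
Finite A = Σ (List A) λ xs → ∀ x → x ∈ xs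

FiniteSupport : {A : Set} → (A → ℕ) → Set
FiniteSupport {A} f = Σ (List A) λ xs → ∀ x → 0 < f x → x ∈ xs

MSizeOn : {A : Set} → (A → Set) → (A → ℕ) → ℕ → Set
MSizeOn {A} P f n =
  Σ (List A) λ xs →
    Unique xs × All P xs × (∀ x → P x → 0 < f x → x ∈ xs) × sum (map f xs) ≡ n

record Net : Set₁ where
  field
    S    : Set
    T    : Set
    pre  : S → T → ℕ          -- F(s,t)
    post : T → S → ℕ          -- F(t,s)
    M0   : S → ℕ
    preFinite    : ∀ t → FiniteSupport (λ s → pre s t)
    preNonEmpty  : ∀ t → Σ S λ s → 0 < pre s t
    postFinite   : ∀ t → FiniteSupport (post t)

  Marking : Set
  Marking = S → ℕ

  Step : Marking → T → Marking → Set
  Step M t M' = (∀ s → pre s t ≤ M s) × (∀ s → M' s ≡ (M s ∸ pre s t) + post t s)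

  FiresFrom : Marking → List T → Set
  FiresFrom M []      = ⊤
  FiresFrom M (t ∷ σ) = Σ Marking λ M' → Step M t M' × FiresFrom M' σ

  FiresFromω : Marking → (ℕ → T) → Set
  FiresFromω M σ = Σ (ℕ → Marking) λ Ms →
    (∀ s → Ms 0 s ≡ M s) × (∀ i → Step (Ms i) (σ i) (Ms (suc i)))

  Node : Set
  Node = S ⊎ T

  Flow : Node → Node → Set
  Flow (inj₁ s) (inj₂ t) = 0 < pre s t
  Flow (inj₂ t) (inj₁ s) = 0 < post t s
  Flow (inj₁ _) (inj₁ _) = ⊥
  Flow (inj₂ _) (inj₂ _) = ⊥

  Flow⁺ : Node → Node → Set
  Flow⁺ = TransClosure Flow

data Word (A : Set) : Set where
  fin : List A → Word A
  inf : (ℕ → A) → Word A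

_≤w_ : {A : Set} → Word A → Word A → Set
fin u ≤w fin v = Σ (List _) λ w → v ≡ u Data.List.++ w
  where import Data.List
fin u ≤w inf f = ∀ (i : Fin (length u)) → lookup u i ≡ f (toℕ i)
inf _ ≤w fin _ = ⊥
inf f ≤w inf g = ∀ i → f i ≡ g i

module _ (N : Net) where
  open Net N

  FSω : Word T → Set
  FSω (fin σ) = FiresFrom M0 σ
  FSω (inf σ) = FiresFromω M0 σ

  FS : List T → Set
  FS σ = FiresFrom M0 σ

record GRProcess (N : Net) : Set₁ where
  open Net N
  field
    𝒩  : Net
  open Net 𝒩 renaming (S to 𝒮; T to 𝒯; pre to 𝓅re; post to 𝓅ost; M0 to ℳ0;
                        Flow⁺ to ℱ⁺; Node to 𝒩ode) public
  field
    inDeg≤1   : ∀ s → (∀ t → 𝓅ost t s ≤ 1) ×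
                      (∀ t t' → 0 < 𝓅ost t s → 0 < 𝓅ost t' s → t ≡ t')
    outDeg≤1  : ∀ s → (∀ t → 𝓅re s t ≤ 1) ×
                      (∀ t t' → 0 < 𝓅re s t → 0 < 𝓅re s t' → t ≡ t')
    initEmpty    : ∀ s → (∀ t → 𝓅ost t s ≡ 0) → ℳ0 s ≡ 1
    initNonEmpty : ∀ s → ¬ (∀ t → 𝓅ost t s ≡ 0) → ℳ0 s ≡ 0
    acyclic   : ∀ x → ¬ ℱ⁺ x x
    finPast   : ∀ u → Σ (List 𝒯) λ ts → ∀ t → ℱ⁺ (inj₂ t) (inj₂ u) → t ∈ ts
    πS        : 𝒮 → S
    πT        : 𝒯 → T
    πM0       : ∀ s → MSizeOn (λ s' → πS s' ≡ s) ℳ0 (M0 s)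
    πpre      : ∀ t s → MSizeOn (λ s' → πS s' ≡ s) (λ s' → 𝓅re s' t) (pre s (πT t))
    πpost     : ∀ t s → MSizeOn (λ s' → πS s' ≡ s) (𝓅ost t) (post (πT t) s)

module _ {N : Net} where
  open Net N

  FiniteProcess : GRProcess N → Set
  FiniteProcess P = Finite (GRProcess.𝒯 P)

  -- P' ≤ P : P' is a prefix of P (subsets given by injective inclusions)
  record _≼_ (P' P : GRProcess N) : Set where
    module P' = GRProcess P'
    module P = GRProcess P
    field
      ιS      : P'.𝒮 → P.𝒮
      ιT      : P'.𝒯 → P.𝒯
      ιS-inj  : Injective _≡_ _≡_ ιS
      ιT-inj  : Injective _≡_ _≡_ ιT
      init⊆   : ∀ s → 0 < P.ℳ0 s → Σ P'.𝒮 λ s' → ιS s' ≡ s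
      init≡   : ∀ s' → P'.ℳ0 s' ≡ P.ℳ0 (ιS s')
      pre≡    : ∀ s t → P'.𝓅re s t ≡ P.𝓅re (ιS s) (ιT t)
      post≡   : ∀ t s → P'.𝓅ost t s ≡ P.𝓅ost (ιT t) (ιS s)
      πS≡     : ∀ s → P'.πS s ≡ P.πS (ιS s)
      πT≡     : ∀ t → P'.πT t ≡ P.πT (ιT t)

  Compatible : GRProcess N → Word T → Set
  Compatible P (fin σ) = Σ (𝒯 → Fin (length σ)) λ pos →
      Bijective _≡_ _≡_ pos ×
      (∀ t → πT t ≡ lookup σ (pos t)) ×
      (∀ t t' → ℱ⁺ (inj₂ t) (inj₂ t') → toℕ (pos t) Data.Nat.< toℕ (pos t'))
    where open GRProcess P
          import Data.Nat
  Compatible P (inf σ) = Σ (𝒯 → ℕ) λ pos →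
      Bijective _≡_ _≡_ pos ×
      (∀ t → πT t ≡ σ (pos t)) ×
      (∀ t t' → ℱ⁺ (inj₂ t) (inj₂ t') → pos t < pos t')
    where open GRProcess P

  Lin : GRProcess N → Word T → Set
  Lin P σ = FSω N σ × Compatible P σ

-- The transitions of P at positions below |σ''| form a set that is closed under
-- F⁺-predecessors, because every linearisation respects F⁺. Restricting P to this
-- set of transitions, together with the initially marked places and the places
-- produced by one of them, gives the prefix P''. It is again a GR-process: every
-- input place of a kept transition is either initially marked or produced by an
-- earlier, hence kept, transition (such a producer is found among the finitely
-- many predecessors). It is finite because the positions are injective, and σ''
-- is a linearisation of it via the same positions.
module Submission where

open import Defs
open import Data.List using (List; []; _∷_; length; lookup; map; _++_; allFin)
open import Data.List.Properties using (length-++)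
open import Data.List.Membership.Propositional using (_∈_; lose)
open import Data.List.Membership.Propositional.Properties using (∈-map⁺; ∈-allFin)
open import Data.List.Relation.Unary.Any using (here; there; any?; satisfied)
open import Data.List.Relation.Unary.All as All using (All; []; _∷_)
open import Data.List.Relation.Unary.AllPairs using ([]; _∷_)
open import Data.List.Relation.Unary.Unique.Propositional using (Unique)
open import Data.Nat using (ℕ; _+_; _≤_; _<_; _<?_; _≟_)
open import Data.Nat.Properties
  using ( ≤-irrelevant; ≡-irrelevant; <-trans; ≤-trans; m≤m+n; n>0⇒n≢0; 1+n≢0; suc-injective
        ; ≮⇒≥; n≤0⇒n≡0)
open import Data.Nat.ListAction using (sum)
open import Data.Fin using (Fin; toℕ; fromℕ<; zero; suc)
open import Data.Fin.Properties using (toℕ-fromℕ<; toℕ<n; toℕ-injective)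
open import Data.Product using (Σ; ∃; _×_; _,_; proj₁; proj₂)
open import Data.Sum using (_⊎_; inj₁; inj₂)
open import Data.Empty using (⊥-elim)
open import Function using (_∘_)
open import Function.Definitions using (Injective)
open import Relation.Nullary using (¬_; yes; no; contradiction)
open import Relation.Binary.PropositionalEquality
  using (_≡_; _≢_; refl; sym; trans; cong; subst)
open import Relation.Binary.Construct.Closure.Transitive using ([_]; _∷_)

≮0⇒≡0 : ∀ {m} → ¬ (0 < m) → m ≡ 0
≮0⇒≡0 m≮0 = n≤0⇒n≡0 (≮⇒≥ m≮0)

lookup-++ˡ : ∀ {A : Set} (xs ys : List A) (i : Fin (length (xs ++ ys))) (j : Fin (length xs)) →
             toℕ i ≡ toℕ j → lookup (xs ++ ys) i ≡ lookup xs j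
lookup-++ˡ (_ ∷ _)  ys zero    zero    _  = refl
lookup-++ˡ (_ ∷ xs) ys (suc i) (suc j) eq = lookup-++ˡ xs ys i j (suc-injective eq)

module SubtypeRestriction {A : Set} (Q : A → Set) (Q-irrelevant : ∀ {a} (q q' : Q a) → q ≡ q') where

  subtype-≡ : ∀ {a a'} {q : Q a} {q' : Q a'} → a ≡ a' → (a , q) ≡ (a' , q')
  subtype-≡ {q = q} {q'} refl = cong (_ ,_) (Q-irrelevant q q')

  module _ (f : A → ℕ) (support⊆Q : ∀ a → 0 < f a → Q a) where

    restrict : List A → List (Σ A Q)
    restrict []       = []
    restrict (a ∷ as) with 0 <? f a
    ... | yes fa>0 = (a , support⊆Q a fa>0) ∷ restrict as
    ... | no  _    = restrict as

    ∈-restrict : ∀ {a} (q : Q a) as → 0 < f a → a ∈ as → (a , q) ∈ restrict as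
    ∈-restrict {a} q (_ ∷ as) fa>0 (here refl) with 0 <? f a
    ... | yes _     = here (subtype-≡ refl)
    ... | no  fa≯0  = contradiction fa>0 fa≯0
    ∈-restrict q (b ∷ as) fa>0 (there a∈as) with 0 <? f b
    ... | yes _ = there (∈-restrict q as fa>0 a∈as)
    ... | no  _ = ∈-restrict q as fa>0 a∈as

    sum-restrict : ∀ as → sum (map (f ∘ proj₁) (restrict as)) ≡ sum (map f as)
    sum-restrict []       = refl
    sum-restrict (a ∷ as) with 0 <? f a
    ... | yes _    = cong (f a +_) (sum-restrict as)
    ... | no  fa≯0 rewrite ≮0⇒≡0 fa≯0 = sum-restrict as

    All-restrict : ∀ {R : A → Set} {as} → All R as → All (R ∘ proj₁) (restrict as)
    All-restrict []                    = []
    All-restrict {as = a ∷ _} (r ∷ rs) with 0 <? f a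
    ... | yes _ = r ∷ All-restrict rs
    ... | no  _ = All-restrict rs

    Unique-restrict : ∀ {as} → Unique as → Unique (restrict as)
    Unique-restrict []                      = []
    Unique-restrict {as = a ∷ _} (a∉ ∷ uniq) with 0 <? f a
    ... | yes _ = All.map (λ a≢b → a≢b ∘ cong proj₁) (All-restrict a∉) ∷ Unique-restrict uniq
    ... | no  _ = Unique-restrict uniq

    MSizeOn-restrict : ∀ {R : A → Set} {k} → MSizeOn R f k → MSizeOn (R ∘ proj₁) (f ∘ proj₁) k
    MSizeOn-restrict (as , uniq , all , covers , total) =
      restrict as , Unique-restrict uniq , All-restrict all ,
      (λ { (a , q) r fa>0 → ∈-restrict q as fa>0 (covers a r fa>0) }) ,
      trans (sum-restrict as) total

    FiniteSupport-restrict : FiniteSupport f → FiniteSupport (f ∘ proj₁)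
    FiniteSupport-restrict (as , covers) =
      restrict as , λ { (a , q) fa>0 → ∈-restrict q as fa>0 (covers a fa>0) }

module PastClosedRestriction {N : Net} (P : GRProcess N) (X : GRProcess.𝒯 P → Set)
  (X-irrelevant : ∀ {t} (x x' : X t) → x ≡ x')
  (X-pastClosed : ∀ {t u} → GRProcess.ℱ⁺ P (inj₂ t) (inj₂ u) → X u → X t)
  (X-finite : Finite (Σ (GRProcess.𝒯 P) X))
  where
  open GRProcess P

  Kept : 𝒮 → Set
  Kept s = (ℳ0 s ≡ 1) ⊎ (∃ λ t → 0 < 𝓅ost t s × X t)

  initial⇒unproduced : ∀ {s t} → ℳ0 s ≡ 1 → ¬ (0 < 𝓅ost t s)
  initial⇒unproduced {s} {t} ℳ0s≡1 produced =
    1+n≢0 (trans (sym ℳ0s≡1) (initNonEmpty s (λ unproduced → n>0⇒n≢0 produced (unproduced t))))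

  produced-then-consumed : ∀ {t' s t} → 0 < 𝓅ost t' s → 0 < 𝓅re s t → ℱ⁺ (inj₂ t') (inj₂ t)
  produced-then-consumed {s = s} produced consumed = _∷_ {y = inj₁ s} produced [ consumed ]

  Kept-irrelevant : ∀ {s} (k k' : Kept s) → k ≡ k'
  Kept-irrelevant (inj₁ e) (inj₁ e') = cong inj₁ (≡-irrelevant e e')
  Kept-irrelevant (inj₁ e) (inj₂ (_ , produced , _)) = ⊥-elim (initial⇒unproduced e produced)
  Kept-irrelevant (inj₂ (_ , produced , _)) (inj₁ e) = ⊥-elim (initial⇒unproduced e produced)
  Kept-irrelevant {s} (inj₂ (t , p , x)) (inj₂ (t' , p' , x'))
    with proj₂ (inDeg≤1 s) t t' p p'
  ... | refl rewrite ≤-irrelevant p p' | X-irrelevant x x' = refl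

  producer : ∀ {s t} → ℳ0 s ≢ 1 → 0 < 𝓅re s t → ∃ λ t' → 0 < 𝓅ost t' s × ℱ⁺ (inj₂ t') (inj₂ t)
  producer {s} {t} ℳ0s≢1 consumed with any? (λ t' → 0 <? 𝓅ost t' s) (proj₁ (finPast t))
  ... | yes found = let (t' , produced) = satisfied found in
                    t' , produced , produced-then-consumed produced consumed
  ... | no none = contradiction (initEmpty s unproduced) ℳ0s≢1
    where
    unproduced : ∀ t' → 𝓅ost t' s ≡ 0
    unproduced t' = ≮0⇒≡0 λ produced →
      none (lose (proj₂ (finPast t) t' (produced-then-consumed produced consumed)) produced)

  Kept-initial : ∀ s → 0 < ℳ0 s → Kept s
  Kept-initial s marked with ℳ0 s ≟ 1
  ... | yes ℳ0s≡1 = inj₁ ℳ0s≡1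
  ... | no  ℳ0s≢1 = contradiction (initNonEmpty s (ℳ0s≢1 ∘ initEmpty s)) (n>0⇒n≢0 marked)

  Kept-pre : ∀ {t} → X t → ∀ s → 0 < 𝓅re s t → Kept s
  Kept-pre x s consumed with ℳ0 s ≟ 1
  ... | yes ℳ0s≡1 = inj₁ ℳ0s≡1
  ... | no  ℳ0s≢1 = let (t' , produced , t'<t) = producer ℳ0s≢1 consumed in
                    inj₂ (t' , produced , X-pastClosed t'<t x)

  Kept-post : ∀ {t} → X t → ∀ s → 0 < 𝓅ost t s → Kept s
  Kept-post x s produced = inj₂ (_ , produced , x)

  module Places = SubtypeRestriction Kept Kept-irrelevant
  module Transitions = SubtypeRestriction X X-irrelevant

  net : Net
  net = record
    { S           = Σ 𝒮 Kept
    ; T           = Σ 𝒯 X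
    ; pre         = λ s t → 𝓅re (proj₁ s) (proj₁ t)
    ; post        = λ t s → 𝓅ost (proj₁ t) (proj₁ s)
    ; M0          = ℳ0 ∘ proj₁
    ; preFinite   = λ { (t , x) → Places.FiniteSupport-restrict _ (Kept-pre x) (preFinite t) }
    ; preNonEmpty = λ { (t , x) → let (s , consumed) = preNonEmpty t in
                                  (s , Kept-pre x s consumed) , consumed }
    ; postFinite  = λ { (t , x) → Places.FiniteSupport-restrict _ (Kept-post x) (postFinite t) }
    }

  embed : Net.Node net → 𝒩ode
  embed (inj₁ s) = inj₁ (proj₁ s)
  embed (inj₂ t) = inj₂ (proj₁ t)

  embed-Flow : ∀ a b → Net.Flow net a b → Flow (embed a) (embed b)
  embed-Flow (inj₁ _) (inj₂ _) flow = flow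
  embed-Flow (inj₂ _) (inj₁ _) flow = flow

  embed-Flow⁺ : ∀ {a b} → Net.Flow⁺ net a b → ℱ⁺ (embed a) (embed b)
  embed-Flow⁺ {a} {b} [ flow ]              = [ embed-Flow a b flow ]
  embed-Flow⁺ {a} (_∷_ {y = c} flow flow⁺) = embed-Flow a c flow ∷ embed-Flow⁺ flow⁺

  initEmpty′ : ∀ (s : Σ 𝒮 Kept) → (∀ (t : Σ 𝒯 X) → 𝓅ost (proj₁ t) (proj₁ s) ≡ 0) → ℳ0 (proj₁ s) ≡ 1
  initEmpty′ (_ , inj₁ ℳ0s≡1)              _          = ℳ0s≡1
  initEmpty′ (_ , inj₂ (t , produced , x)) unproduced = ⊥-elim (n>0⇒n≢0 produced (unproduced (t , x)))

  initNonEmpty′ : ∀ (s : Σ 𝒮 Kept) → ¬ (∀ (t : Σ 𝒯 X) → 𝓅ost (proj₁ t) (proj₁ s) ≡ 0) →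
                  ℳ0 (proj₁ s) ≡ 0
  initNonEmpty′ (_ , inj₁ ℳ0s≡1) produced =
    contradiction (λ _ → ≮0⇒≡0 (initial⇒unproduced ℳ0s≡1)) produced
  initNonEmpty′ (s , inj₂ (t , produced , _)) _ =
    initNonEmpty s (λ unproduced → n>0⇒n≢0 produced (unproduced t))

  restriction : GRProcess N
  restriction = record
    { 𝒩            = net
    ; inDeg≤1      = λ s → (λ t → proj₁ (inDeg≤1 (proj₁ s)) (proj₁ t)) ,
                           λ t t' p p' → Transitions.subtype-≡ (proj₂ (inDeg≤1 (proj₁ s)) _ _ p p')
    ; outDeg≤1     = λ s → (λ t → proj₁ (outDeg≤1 (proj₁ s)) (proj₁ t)) ,
                           λ t t' c c' → Transitions.subtype-≡ (proj₂ (outDeg≤1 (proj₁ s)) _ _ c c')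
    ; initEmpty    = initEmpty′
    ; initNonEmpty = initNonEmpty′
    ; acyclic      = λ a cycle → acyclic (embed a) (embed-Flow⁺ cycle)
    ; finPast      = λ _ → proj₁ X-finite , λ t _ → proj₂ X-finite t
    ; πS           = πS ∘ proj₁
    ; πT           = πT ∘ proj₁
    ; πM0          = λ s → Places.MSizeOn-restrict ℳ0 Kept-initial (πM0 s)
    ; πpre         = λ { (t , x) s → Places.MSizeOn-restrict _ (Kept-pre x) (πpre t s) }
    ; πpost        = λ { (t , x) s → Places.MSizeOn-restrict _ (Kept-post x) (πpost t s) }
    }

  restriction-≼ : restriction ≼ P
  restriction-≼ = record
    { ιS     = proj₁
    ; ιT     = proj₁
    ; ιS-inj = Places.subtype-≡
    ; ιT-inj = Transitions.subtype-≡
    ; init⊆  = λ s marked → (s , Kept-initial s marked) , refl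
    ; init≡  = λ _ → refl
    ; pre≡   = λ _ _ → refl
    ; post≡  = λ _ _ → refl
    ; πS≡    = λ _ → refl
    ; πT≡    = λ _ → refl
    }

record PrefixNumbering {N : Net} (P : GRProcess N) (σ'' : List (Net.T N)) : Set where
  open GRProcess P
  field
    pos           : 𝒯 → ℕ
    pos-injective : Injective _≡_ _≡_ pos
    pos-onto      : ∀ i → i < length σ'' → ∃ λ t → pos t ≡ i
    pos-label     : ∀ t (p : pos t < length σ'') → πT t ≡ lookup σ'' (fromℕ< p)
    pos-monotone  : ∀ {t t'} → ℱ⁺ (inj₂ t) (inj₂ t') → pos t < pos t'

Lin⇒PrefixNumbering : ∀ {N} {P : GRProcess N} {σ σ''} → Lin P σ → fin σ'' ≤w σ → PrefixNumbering P σ''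
Lin⇒PrefixNumbering {σ = fin σ} {σ''} (_ , pos , (injective , onto) , label , monotone) (w , refl) =
  record
    { pos           = toℕ ∘ pos
    ; pos-injective = injective ∘ toℕ-injective
    ; pos-onto      = λ i i<n → let (t , pos-t≡) = onto (fromℕ< (≤-trans i<n |σ''|≤|σ|)) in
                                t , trans (cong toℕ (pos-t≡ refl)) (toℕ-fromℕ< _)
    ; pos-label     = λ t p → trans (label t) (lookup-++ˡ σ'' w (pos t) (fromℕ< p) (sym (toℕ-fromℕ< p)))
    ; pos-monotone  = monotone _ _
    }
  where
  |σ''|≤|σ| : length σ'' ≤ length (σ'' ++ w)
  |σ''|≤|σ| = subst (length σ'' ≤_) (sym (length-++ σ'' {w})) (m≤m+n _ _)
Lin⇒PrefixNumbering {σ = inf σ} (_ , pos , (injective , onto) , label , monotone) σ''≤σ =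
  record
    { pos           = pos
    ; pos-injective = injective
    ; pos-onto      = λ i _ → let (t , pos-t≡) = onto i in t , pos-t≡ refl
    ; pos-label     = λ t p → trans (label t) (sym (trans (σ''≤σ (fromℕ< p)) (cong σ (toℕ-fromℕ< p))))
    ; pos-monotone  = monotone _ _
    }

module Truncation {N : Net} {P : GRProcess N} {σ'' : List (Net.T N)}
  (numbering : PrefixNumbering P σ'') where
  open GRProcess P
  open PrefixNumbering numbering

  Early : 𝒯 → Set
  Early t = pos t < length σ''

  early : ∀ i → i < length σ'' → Σ 𝒯 Early
  early i i<n = let (t , pos-t≡i) = pos-onto i i<n in t , subst (_< length σ'') (sym pos-t≡i) i<n

  early-pos : ∀ i (i<n : i < length σ'') → pos (proj₁ (early i i<n)) ≡ i
  early-pos i i<n = proj₂ (pos-onto i i<n)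

  early-finite : Finite (Σ 𝒯 Early)
  early-finite = map (λ i → early (toℕ i) (toℕ<n i)) (allFin _) , λ (t , p) →
    subst (_∈ _) (Subtype.subtype-≡ (pos-injective (trans (early-pos _ _) (toℕ-fromℕ< p))))
      (∈-map⁺ (λ i → early (toℕ i) (toℕ<n i)) (∈-allFin (fromℕ< p)))
    where module Subtype = SubtypeRestriction Early ≤-irrelevant

  open PastClosedRestriction P Early ≤-irrelevant (λ t<u → <-trans (pos-monotone t<u)) early-finite
    public

  restriction-compatible : Compatible restriction (fin σ'')
  restriction-compatible = pos′ , (injective , onto) , (λ (t , p) → pos-label t p) , monotone
    where
    pos′ : Σ 𝒯 Early → Fin (length σ'')
    pos′ (_ , p) = fromℕ< p

    injective : Injective _≡_ _≡_ pos′
    injective {_ , p} {_ , q} eq = Transitions.subtype-≡ (pos-injective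
      (trans (sym (toℕ-fromℕ< p)) (trans (cong toℕ eq) (toℕ-fromℕ< q))))

    onto : ∀ i → ∃ λ t → ∀ {t'} → t' ≡ t → pos′ t' ≡ i
    onto i = early (toℕ i) (toℕ<n i) , λ { refl → toℕ-injective
      (trans (toℕ-fromℕ< _) (early-pos (toℕ i) (toℕ<n i))) }

    monotone : ∀ t t' → Net.Flow⁺ net (inj₂ t) (inj₂ t') → toℕ (pos′ t) < toℕ (pos′ t')
    monotone (_ , p) (_ , q) flow⁺ rewrite toℕ-fromℕ< p | toℕ-fromℕ< q = pos-monotone (embed-Flow⁺ flow⁺)

lemma4 : (N : Net) (P : GRProcess N) (σ : Word (Net.T N)) → Lin P σ →
         (σ'' : List (Net.T N)) → FS N σ'' → fin σ'' ≤w σ →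
         Σ (GRProcess N) λ P'' → FiniteProcess P'' × Lin P'' (fin σ'') × (P'' ≼ P)
lemma4 N P σ σ∈Lin σ'' σ''-fires σ''≤σ =
  restriction , early-finite , (σ''-fires , restriction-compatible) , restriction-≼
  where
  open Truncation (Lin⇒PrefixNumbering σ∈Lin σ''≤σ)
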